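{- Let $q$ be a prime power and $\lambda,n,k,t$ positive integers with $1 \le t \le k \le n$, $1 \le \lambda \le \binom{n-t}{k-t}_q$, and $(\lambda+1)k - \lambda n \ge t$. Then $\mathcal{A}_q(n,k,t;\lambda) = \lambda$.
   Context: $\binom{a}{b}_q$ denotes the Gaussian binomial coefficient, the number of $b$-dimensional subspaces of $\mathbb{F}_q^a$. A $t$-$(n,k,\lambda)_q$ subspace packing is a collection of $k$-dimensional subspaces (blocks) of $\mathbb{F}_q^n$ such that every $t$-dimensional subspace of $\mathbb{F}_q^n$ is contained in at most $\lambda$ blocks. $\mathcal{A}_q(n,k,t;\lambda)$ denotes the maximum number of blocks of such a packing without repeated blocks (i.e., the blocks form a set). -}

module Defs where

open import Level using (Level; _⊔_) renaming (suc to lsuc)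
open import Data.Nat using (ℕ; zero; suc)
open import Data.Nat as N using ()
import Data.Fin as Fin
open Fin using (Fin)
import Data.Nat
import Data.Product
open import Data.Product using (Σ; ∃; _×_; _,_)
open import Relation.Nullary using (¬_)
open import Relation.Binary.PropositionalEquality using (_≡_)
open import Algebra.Bundles using (CommutativeRing)
open import Function.Definitions using (Injective)

-- Gaussian binomial coefficient [a choose b]_q, via the q-Pascal recursion
-- [a+1, b+1]_q = [a, b]_q + q^(b+1) [a, b+1]_q.
gauss : ℕ → ℕ → ℕ → ℕ
gauss q zero    zero    = 1
gauss q zero    (suc b) = 0
gauss q (suc a) zero    = 1
gauss q (suc a) (suc b) = gauss q a b N.+ (q N.^ suc b) N.* gauss q a (suc b)

record Field (c ℓ : Level) : Set (lsuc (c ⊔ ℓ)) where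
  field
    commRing : CommutativeRing c ℓ
  open CommutativeRing commRing public
  field
    1≉0     : ¬ (1# ≈ 0#)
    inverse : ∀ x → ¬ (x ≈ 0#) → Σ Carrier λ y → (x * y) ≈ 1#

record FiniteField (c ℓ : Level) (q : ℕ) : Set (lsuc (c ⊔ ℓ)) where
  field
    fld   : Field c ℓ
  open Field fld public
  field
    enum      : Fin q → Carrier
    enum-inj  : ∀ i j → enum i ≈ enum j → i ≡ j
    enum-surj : ∀ x → Σ (Fin q) λ i → enum i ≈ x

module Linear {c ℓ : Level} {q : ℕ} (F : FiniteField c ℓ q) (n : ℕ) where
  open FiniteField F

  Vec : Set c
  Vec = Fin n → Carrier

  _≈v_ : Vec → Vec → Set ℓ
  u ≈v v = ∀ i → u i ≈ v i

  zeroV : Vec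
  zeroV _ = 0#

  _+v_ : Vec → Vec → Vec
  (u +v v) i = u i + v i

  _·_ : Carrier → Vec → Vec
  (a · v) i = a * v i

  lincomb : (m : ℕ) → (Fin m → Carrier) → (Fin m → Vec) → Vec
  lincomb zero    coef vs = zeroV
  lincomb (suc m) coef vs =
    (coef Fin.zero · vs Fin.zero) +v lincomb m (λ i → coef (Fin.suc i)) (λ i → vs (Fin.suc i))

  LinIndep : (m : ℕ) → (Fin m → Vec) → Set (c ⊔ ℓ)
  LinIndep m vs = ∀ coef → lincomb m coef vs ≈v zeroV → ∀ i → coef i ≈ 0#

  Basis : ℕ → Set (c ⊔ ℓ)
  Basis m = Σ (Fin m → Vec) (LinIndep m)

  _∈⟨_⟩ : {m : ℕ} → Vec → Basis m → Set (c ⊔ ℓ)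
  _∈⟨_⟩ {m} v (vs , _) = Σ (Fin m → Carrier) λ coef → v ≈v lincomb m coef vs

  _⊆⟨⟩_ : {s m : ℕ} → Basis s → Basis m → Set (c ⊔ ℓ)
  _⊆⟨⟩_ {s} T B = ∀ (i : Fin s) → (Data.Product.proj₁ T i) ∈⟨ B ⟩

  _≡⟨⟩_ : {s m : ℕ} → Basis s → Basis m → Set (c ⊔ ℓ)
  B ≡⟨⟩ B' = B ⊆⟨⟩ B' × B' ⊆⟨⟩ B

  -- A t-(n,k,λ)_q subspace packing with M blocks and no repeated blocks:
  -- M pairwise distinct k-dimensional subspaces such that every t-dimensional
  -- subspace T is contained in at most λ of them, i.e. there are no λ+1
  -- distinct block indices whose blocks all contain T.
  record Packing (k t λ' M : ℕ) : Set (c ⊔ ℓ) where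
    field
      block    : Fin M → Basis k
      distinct : ∀ i j → block i ≡⟨⟩ block j → i ≡ j
      atMost   : (T : Basis t) (f : Fin (suc λ') → Fin M) → Injective _≡_ _≡_ f →
                 ¬ (∀ a → T ⊆⟨⟩ block (f a))

  -- 𝒜_q(n,k,t;λ) = A : A is the maximum number of blocks of such a packing.
  MaxPacking : (k t λ' A : ℕ) → Set (c ⊔ ℓ)
  MaxPacking k t λ' A = Packing k t λ' A × (∀ M → Packing k t λ' M → M Data.Nat.≤ A)

-- By the dimension formula dim(U ∩ W) ≥ dim U + dim W − n,
-- any λ+1 subspaces of dimension k of F_q^n meet in a subspace of dimension
-- at least (λ+1)k − λn ≥ t, hence have a common t-dimensional subspace; so a
-- packing with more than λ blocks would violate the packing condition.  The
-- dimension formula is derived from the fact that a homogeneous linear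
-- system with more unknowns than equations has many independent solutions
-- ('kernel', proved by Gaussian elimination over any field with decidable
-- equality).
--
-- Any λ distinct k-subspaces form a packing, since no
-- t-subspace can lie in λ+1 distinct blocks when there are only λ.  If k < n
-- the hypothesis forces λ ≤ k, and the λ coordinate hyperplanes of a
-- (k+1)-dimensional coordinate subspace are distinct; if k = n the hypothesis
-- forces λ ≤ [n−t, n−t]_q = 1 and the whole space is a single block.
module Submission where

open import Defs
open import Level using (Level; _⊔_)
import Data.Nat
open import Data.Nat as ℕ using (ℕ; zero; suc; _∸_; _≤_; _<_; s≤s; z≤n)
import Data.Nat.Properties as ℕₚ
open import Data.Fin as Fin using (Fin; zero; suc; _↑ˡ_; _↑ʳ_; punchIn; inject≤)
import Data.Fin.Properties as Finₚ
open import Data.Vec.Functional using (Vector; insertAt; _++_)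
import Data.Vec.Functional.Properties as Vecₚ
open import Data.Product using (Σ; ∃; _,_; proj₁; proj₂; _×_)
open import Data.Sum using (_⊎_; inj₁; inj₂)
open import Function using (_∘_)
open import Function.Definitions using (Injective)
open import Relation.Nullary using (¬_; yes; no; contradiction)
open import Relation.Binary using (Decidable)
open import Relation.Binary.PropositionalEquality as ≡ using (_≡_; _≢_)
open import Algebra.Bundles using (CommutativeRing; AbelianGroup)
import Algebra.Properties.Semiring.Sum as SemiringSum
import Algebra.Properties.Ring as RingProperties

gauss-above : ∀ q {a b} → a < b → gauss q a b ≡ 0
gauss-above q {zero}  {suc b} _ = ≡.refl
gauss-above q {suc a} {suc b} (s≤s a<b)
  rewrite gauss-above q a<b | gauss-above q (ℕₚ.m<n⇒m<1+n a<b) | ℕₚ.*-zeroʳ (q ℕ.^ suc b) = ≡.refl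

gauss-diagonal : ∀ q a → gauss q a a ≡ 1
gauss-diagonal q zero = ≡.refl
gauss-diagonal q (suc a)
  rewrite gauss-diagonal q a | gauss-above q (ℕₚ.n<1+n a) | ℕₚ.*-zeroʳ (q ℕ.^ suc a) = ≡.refl

module _ {c ℓ q} (F : FiniteField c ℓ q) where
  open FiniteField F

  -- Equality in a finite field is decidable: compare enumeration indices.
  finite-≟ : Decidable _≈_
  finite-≟ x y with enum-surj x | enum-surj y
  ... | i , i↦x | j , j↦y with i Fin.≟ j
  ...   | yes ≡.refl = yes (trans (sym i↦x) j↦y)
  ...   | no  i≢j    = no λ x≈y → i≢j (enum-inj i j (trans i↦x (trans x≈y (sym j↦y))))

module FiniteSums {c ℓ} (R : CommutativeRing c ℓ) where
  open CommutativeRing R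
  open RingProperties ring using (-1*x≈-x)
  open SemiringSum semiring public
    using (sum; sum-cong-≋; sum-cong-≗; sum-replicate-zero; sum-remove;
           ∑-distrib-+; ∑-comm; *-distribˡ-sum; *-distribʳ-sum)
  open import Relation.Binary.Reasoning.Setoid setoid

  -- ∑[ i < n ] f i, binding tighter than + and looser than *, as usual in
  -- mathematics (the library's notation binds tighter than *).
  ∑-syntax : ∀ n → Vector Carrier n → Carrier
  ∑-syntax _ = sum

  infixr 6.5 ∑-syntax
  syntax ∑-syntax n (λ i → x) = ∑[ i < n ] x

  ∑-zero : ∀ {m} (f : Vector Carrier m) → (∀ i → f i ≈ 0#) → sum f ≈ 0#
  ∑-zero {m} f f≈0 = trans (sum-cong-≋ {m} f≈0) (sum-replicate-zero m)

  ∑-split : ∀ a {b} (f : Vector Carrier (a ℕ.+ b)) →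
            sum f ≈ ∑[ i < a ] f (i ↑ˡ b) + ∑[ j < b ] f (a ↑ʳ j)
  ∑-split zero    f = sym (+-identityˡ _)
  ∑-split (suc a) f = trans (+-congˡ (∑-split a (f ∘ suc))) (sym (+-assoc _ _ _))

  ∑-negate : ∀ {m} (f : Vector Carrier m) → - sum f ≈ ∑[ i < m ] - f i
  ∑-negate {m} f = begin
    - sum f               ≈⟨ -1*x≈-x (sum f) ⟨
    - 1# * sum f          ≈⟨ *-distribˡ-sum (- 1#) f ⟩
    ∑[ i < m ] - 1# * f i ≈⟨ sum-cong-≋ {m} (λ i → -1*x≈-x (f i)) ⟩
    ∑[ i < m ] - f i      ∎

  ∑-mul-assoc : ∀ {d m} (e : Vector Carrier d) (C : Fin d → Vector Carrier m) (u : Vector Carrier m) →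
                ∑[ s < d ] e s * (∑[ i < m ] C s i * u i) ≈ ∑[ i < m ] (∑[ s < d ] e s * C s i) * u i
  ∑-mul-assoc {d} {m} e C u = begin
    ∑[ s < d ] e s * (∑[ i < m ] C s i * u i)
      ≈⟨ sum-cong-≋ {d} (λ s → *-distribˡ-sum (e s) (λ i → C s i * u i)) ⟩
    ∑[ s < d ] ∑[ i < m ] e s * (C s i * u i)
      ≈⟨ ∑-comm {d} {m} (λ s i → e s * (C s i * u i)) ⟩
    ∑[ i < m ] ∑[ s < d ] e s * (C s i * u i)
      ≈⟨ sum-cong-≋ {m} (λ i → sum-cong-≋ {d} (λ s → sym (*-assoc (e s) (C s i) (u i)))) ⟩
    ∑[ i < m ] ∑[ s < d ] e s * C s i * u i
      ≈⟨ sum-cong-≋ {m} (λ i → *-distribʳ-sum (u i) (λ s → e s * C s i)) ⟨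
    ∑[ i < m ] (∑[ s < d ] e s * C s i) * u i ∎

  δ : ∀ {N} → Fin N → Vector Carrier N
  δ x y with x Fin.≟ y
  ... | yes _ = 1#
  ... | no  _ = 0#

  δ-diagonal : ∀ {N} (x : Fin N) → δ x x ≈ 1#
  δ-diagonal x with x Fin.≟ x
  ... | yes _   = refl
  ... | no  x≢x = contradiction ≡.refl x≢x

  δ-off : ∀ {N} {x y : Fin N} → x ≢ y → δ x y ≈ 0#
  δ-off {x = x} {y} x≢y with x Fin.≟ y
  ... | yes x≡y = contradiction x≡y x≢y
  ... | no  _   = refl

  ∑-δ-miss : ∀ {d N} (e : Vector Carrier d) (ι : Fin d → Fin N) y →
             (∀ s → ι s ≢ y) → ∑[ s < d ] e s * δ (ι s) y ≈ 0#
  ∑-δ-miss e ι y y∉ι =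
    ∑-zero (λ s → e s * δ (ι s) y) (λ s → trans (*-congˡ (δ-off (y∉ι s))) (zeroʳ (e s)))

  ∑-δ-hit : ∀ {d N} (e : Vector Carrier d) (ι : Fin d → Fin N) → Injective _≡_ _≡_ ι →
            ∀ s₀ → ∑[ s < d ] e s * δ (ι s) (ι s₀) ≈ e s₀
  ∑-δ-hit {suc d} e ι ι-inj s₀ = begin
    ∑[ s < suc d ] e s * δ (ι s) (ι s₀)
      ≈⟨ sum-remove {d} {s₀} (λ s → e s * δ (ι s) (ι s₀)) ⟩
    e s₀ * δ (ι s₀) (ι s₀) + ∑[ s < d ] e (punchIn s₀ s) * δ (ι (punchIn s₀ s)) (ι s₀)
      ≈⟨ +-cong (trans (*-congˡ (δ-diagonal (ι s₀))) (*-identityʳ (e s₀)))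
                (∑-δ-miss (e ∘ punchIn s₀) (ι ∘ punchIn s₀) (ι s₀)
                          (λ s eq → Finₚ.punchInᵢ≢i s₀ s (ι-inj eq))) ⟩
    e s₀ + 0#
      ≈⟨ +-identityʳ (e s₀) ⟩
    e s₀ ∎

module Kernel {c ℓ} (F : Field c ℓ) (_≟_ : Decidable (Field._≈_ F)) where
  open Field F hiding (zero)
  open FiniteSums commRing
  open RingProperties ring using (-‿distribˡ-*)
  open import Relation.Binary.Reasoning.Setoid setoid

  Matrix : ℕ → ℕ → Set c
  Matrix m n = Fin m → Vector Carrier n

  Independent : ∀ {d m} → (Fin d → Vector Carrier m) → Set (c ⊔ ℓ)
  Independent {d} cs = ∀ (e : Vector Carrier d) → (∀ i → ∑[ s < d ] e s * cs s i ≈ 0#) → ∀ s → e s ≈ 0#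

  record Relations {m n} (A : Matrix m n) (d : ℕ) : Set (c ⊔ ℓ) where
    field
      coeff       : Fin d → Vector Carrier m
      annihilates : ∀ s j → ∑[ i < m ] coeff s i * A i j ≈ 0#
      independent : Independent coeff
  open Relations

  -- With no columns every vector is a relation; take d unit vectors.
  emptyRelations : ∀ {m} d → d ≤ m → (A : Matrix m 0) → Relations A d
  emptyRelations {m} d d≤m A = record
    { coeff       = λ s → δ (ι s)
    ; annihilates = λ s ()
    ; independent = λ e e·δ≈0 s → trans (sym (∑-δ-hit e ι ι-inj s)) (e·δ≈0 (ι s))
    }
    where
      ι : Fin d → Fin m
      ι s = inject≤ s d≤m
      ι-inj : Injective _≡_ _≡_ ι
      ι-inj = Finₚ.inject≤-injective d≤m d≤m _ _

  -- A zero column imposes no condition on relations.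
  dropZeroColumn : ∀ {m n d} (A : Matrix m (suc n)) → (∀ i → A i zero ≈ 0#) →
                   Relations (λ i j → A i (suc j)) d → Relations A d
  dropZeroColumn A zeroColumn R = record
    { coeff       = coeff R
    ; annihilates = λ { s zero    → ∑-zero (λ i → coeff R s i * A i zero)
                                          (λ i → trans (*-congˡ (zeroColumn i)) (zeroʳ (coeff R s i)))
                      ; s (suc j) → annihilates R s j }
    ; independent = independent R
    }

  -- Elimination with a pivot A p j₀ ≉ 0: subtracting multiples of row p
  -- from the other rows clears column j₀, and relations of the reduced
  -- matrix lift to relations of A.
  module Pivot {m n} (A : Matrix (suc m) n) (p : Fin (suc m)) (j₀ : Fin n)
               (pivot≉0 : ¬ A p j₀ ≈ 0#) where

    pivot⁻¹ : Carrier
    pivot⁻¹ = proj₁ (inverse (A p j₀) pivot≉0)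

    μ : Fin m → Carrier
    μ i = - (A (punchIn p i) j₀ * pivot⁻¹)

    reduced : Matrix m n
    reduced i j = A (punchIn p i) j + μ i * A p j

    reduced-clears : ∀ i → reduced i j₀ ≈ 0#
    reduced-clears i = begin
      a + μ i * A p j₀                 ≈⟨ +-congˡ (-‿distribˡ-* (a * pivot⁻¹) (A p j₀)) ⟨
      a + - (a * pivot⁻¹ * A p j₀)     ≈⟨ +-congˡ (-‿cong (*-assoc a pivot⁻¹ (A p j₀))) ⟩
      a + - (a * (pivot⁻¹ * A p j₀))   ≈⟨ +-congˡ (-‿cong (*-congˡ inverse-pivot)) ⟩
      a + - (a * 1#)                   ≈⟨ +-congˡ (-‿cong (*-identityʳ a)) ⟩
      a + - a                          ≈⟨ -‿inverseʳ a ⟩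
      0#                               ∎
      where
        a = A (punchIn p i) j₀
        inverse-pivot : pivot⁻¹ * A p j₀ ≈ 1#
        inverse-pivot = trans (*-comm pivot⁻¹ (A p j₀)) (proj₂ (inverse (A p j₀) pivot≉0))

    lift-value : Vector Carrier m → Carrier
    lift-value c = ∑[ i < m ] c i * μ i

    lift : Vector Carrier m → Vector Carrier (suc m)
    lift c = insertAt c p (lift-value c)

    lift-∑ : ∀ c j → ∑[ x < suc m ] lift c x * A x j ≈ ∑[ i < m ] c i * reduced i j
    lift-∑ c j = begin
      ∑[ x < suc m ] lift c x * A x j
        ≈⟨ sum-remove {m} {p} (λ x → lift c x * A x j) ⟩
      lift c p * A p j + ∑[ i < m ] lift c (punchIn p i) * A (punchIn p i) j
        ≡⟨ ≡.cong₂ (λ u v → u * A p j + v) (Vecₚ.insertAt-lookup c p (lift-value c))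
                   (sum-cong-≗ {m} (λ i → ≡.cong (_* A (punchIn p i) j) (Vecₚ.insertAt-punchIn c p (lift-value c) i))) ⟩
      (∑[ i < m ] c i * μ i) * A p j + ∑[ i < m ] c i * A (punchIn p i) j
        ≈⟨ +-comm _ _ ⟩
      ∑[ i < m ] c i * A (punchIn p i) j + (∑[ i < m ] c i * μ i) * A p j
        ≈⟨ +-congˡ (*-distribʳ-sum (A p j) (λ i → c i * μ i)) ⟩
      ∑[ i < m ] c i * A (punchIn p i) j + ∑[ i < m ] c i * μ i * A p j
        ≈⟨ ∑-distrib-+ {m} (λ i → c i * A (punchIn p i) j) (λ i → c i * μ i * A p j) ⟨
      ∑[ i < m ] (c i * A (punchIn p i) j + c i * μ i * A p j)
        ≈⟨ sum-cong-≋ {m} (λ i → trans (+-congˡ (*-assoc (c i) (μ i) (A p j)))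
                                       (sym (distribˡ (c i) (A (punchIn p i) j) (μ i * A p j)))) ⟩
      ∑[ i < m ] c i * reduced i j ∎

    liftRelations : ∀ {d} → Relations reduced d → Relations A d
    liftRelations {d} R = record
      { coeff       = lift ∘ coeff R
      ; annihilates = λ s j → trans (lift-∑ (coeff R s) j) (annihilates R s j)
      ; independent = λ e e·lift≈0 → independent R e λ i →
          trans (reflexive (sum-cong-≗ {d} (λ s → ≡.cong (e s *_)
                   (≡.sym (Vecₚ.insertAt-punchIn (coeff R s) p (lift-value (coeff R s)) i)))))
                (e·lift≈0 (punchIn p i))
      }

  zeroOrPivot : ∀ {m} (v : Vector Carrier m) → (∀ i → v i ≈ 0#) ⊎ ∃ λ p → ¬ v p ≈ 0#
  zeroOrPivot {m} v with Finₚ.all? (λ i → v i ≟ 0#)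
  ... | yes allZero  = inj₁ allZero
  ... | no  someNonzero = inj₂ (Finₚ.¬∀⟶∃¬ m (λ i → v i ≈ 0#) (λ i → v i ≟ 0#) someNonzero)

  kernel : ∀ n {m} d → d ℕ.+ n ≤ m → (A : Matrix m n) → Relations A d
  kernel zero d d+0≤m A =
    emptyRelations d (ℕₚ.≤-trans (ℕₚ.m≤m+n d 0) d+0≤m) A
  kernel (suc n) d d+n+1≤m A with zeroOrPivot (λ i → A i zero)
  ... | inj₁ zeroColumn =
    dropZeroColumn A zeroColumn (kernel n d (ℕₚ.≤-trans (ℕₚ.+-monoʳ-≤ d (ℕₚ.n≤1+n n)) d+n+1≤m)
                                        (λ i j → A i (suc j)))
  kernel (suc n) {suc m} d d+n+1≤m A | inj₂ (p , pivot≉0) =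
    liftRelations (dropZeroColumn reduced reduced-clears (kernel n d d+n≤m (λ i j → reduced i (suc j))))
    where
      open Pivot A p zero pivot≉0
      d+n≤m : d ℕ.+ n ≤ m
      d+n≤m = ℕₚ.≤-pred (≡.subst (_≤ suc m) (ℕₚ.+-suc d n) d+n+1≤m)

module Arithmetic where
  open Data.Nat using (_+_; _*_)

  -- Inductive step: with d' = d + n − k, L further subspaces suffice for d'.
  commonDimension-step : ∀ {n k d L} → k ≤ n →
                         d + suc L * n ≤ n + suc L * k → (d + n ∸ k) + L * n ≤ n + L * k
  commonDimension-step {n} {k} {d} {L} k≤n hyp = ℕₚ.+-cancelʳ-≤ k _ _ (begin
    (d + n ∸ k) + L * n + k   ≡⟨ ℕₚ.+-comm ((d + n ∸ k) + L * n) k ⟩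
    k + ((d + n ∸ k) + L * n) ≡⟨ ℕₚ.+-assoc k (d + n ∸ k) (L * n) ⟨
    k + (d + n ∸ k) + L * n   ≡⟨ ≡.cong (_+ L * n) (ℕₚ.m+[n∸m]≡n k≤d+n) ⟩
    d + n + L * n             ≡⟨ ℕₚ.+-assoc d n (L * n) ⟩
    d + suc L * n             ≤⟨ hyp ⟩
    n + (k + L * k)           ≡⟨ ≡.cong (n +_) (ℕₚ.+-comm k (L * k)) ⟩
    n + (L * k + k)           ≡⟨ ℕₚ.+-assoc n (L * k) k ⟨
    n + L * k + k             ∎)
    where
      open ℕₚ.≤-Reasoning
      k≤d+n : k ≤ d + n
      k≤d+n = ℕₚ.≤-trans k≤n (ℕₚ.m≤n+m n d)

  -- The paper's condition (λ+1)k − λn ≥ t, as needed for λ+1 subspaces.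
  commonDimension-packing : ∀ {n k t λ'} → λ' * n + t ≤ suc λ' * k → t + suc λ' * n ≤ n + suc λ' * k
  commonDimension-packing {n} {k} {t} {λ'} hyp = begin
    t + (n + λ' * n)  ≡⟨ ℕₚ.+-assoc t n (λ' * n) ⟨
    t + n + λ' * n    ≡⟨ ≡.cong (_+ λ' * n) (ℕₚ.+-comm t n) ⟩
    n + t + λ' * n    ≡⟨ ℕₚ.+-assoc n t (λ' * n) ⟩
    n + (t + λ' * n)  ≡⟨ ≡.cong (n +_) (ℕₚ.+-comm t (λ' * n)) ⟩
    n + (λ' * n + t)  ≤⟨ ℕₚ.+-monoʳ-≤ n hyp ⟩
    n + suc λ' * k    ∎
    where open ℕₚ.≤-Reasoning

  condition⇒λ≤k : ∀ {n k t λ'} → λ' * n + t ≤ suc λ' * k → suc k ≤ n → λ' ≤ k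
  condition⇒λ≤k {n} {k} {t} {λ'} hyp k<n = ℕₚ.+-cancelʳ-≤ (λ' * k) λ' k (begin
    λ' + λ' * k   ≡⟨ ℕₚ.*-suc λ' k ⟨
    λ' * suc k    ≤⟨ ℕₚ.*-monoʳ-≤ λ' k<n ⟩
    λ' * n        ≤⟨ ℕₚ.m≤m+n (λ' * n) t ⟩
    λ' * n + t    ≤⟨ hyp ⟩
    k + λ' * k    ∎)
    where open ℕₚ.≤-Reasoning

open Arithmetic

module Subspaces {c ℓ q} (F : FiniteField c ℓ q) (n : ℕ) where
  open FiniteField F hiding (zero)
  open Linear F n
  open FiniteSums commRing
  open Kernel fld (finite-≟ F)
  open Relations
  open RingProperties ring using (-‿distribˡ-*)
  open import Algebra.Properties.Group (AbelianGroup.group +-abelianGroup) using (inverseˡ-unique)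
  open import Relation.Binary.Reasoning.Setoid setoid

  lincomb-∑ : ∀ m coef (vs : Fin m → Vec) x → lincomb m coef vs x ≡ ∑[ i < m ] coef i * vs i x
  lincomb-∑ zero    coef vs x = ≡.refl
  lincomb-∑ (suc m) coef vs x = ≡.cong (coef zero * vs zero x +_) (lincomb-∑ m (coef ∘ suc) (vs ∘ suc) x)

  linIndep⇒independent : ∀ {m} {vs : Fin m → Vec} → LinIndep m vs → Independent vs
  linIndep⇒independent {m} {vs} ind e e·vs≈0 =
    ind e (λ x → trans (reflexive (lincomb-∑ m e vs x)) (e·vs≈0 x))

  independent⇒linIndep : ∀ {m} {vs : Fin m → Vec} → Independent vs → LinIndep m vs
  independent⇒linIndep {m} {vs} ind e e·vs≈0 =
    ind e (λ x → trans (reflexive (≡.sym (lincomb-∑ m e vs x))) (e·vs≈0 x))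

  ⊆-trans : ∀ {r s m} (X : Basis r) (Y : Basis s) (Z : Basis m) → X ⊆⟨⟩ Y → Y ⊆⟨⟩ Z → X ⊆⟨⟩ Z
  ⊆-trans {s = s} {m} (xs , _) (ys , _) (zs , _) X⊆Y Y⊆Z i = coef , λ x → begin
    xs i x                                          ≈⟨ proj₂ (X⊆Y i) x ⟩
    lincomb s a ys x                                ≡⟨ lincomb-∑ s a ys x ⟩
    ∑[ j < s ] a j * ys j x                         ≈⟨ sum-cong-≋ {s} (λ j → *-congˡ (trans (proj₂ (Y⊆Z j) x)
                                                                            (reflexive (lincomb-∑ m (b j) zs x)))) ⟩
    ∑[ j < s ] a j * (∑[ l < m ] b j l * zs l x)    ≈⟨ ∑-mul-assoc a b (λ l → zs l x) ⟩
    ∑[ l < m ] coef l * zs l x                      ≡⟨ lincomb-∑ m coef zs x ⟨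
    lincomb m coef zs x                             ∎
    where
      a = proj₁ (X⊆Y i)
      b = λ j → proj₁ (Y⊆Z j)
      coef = λ l → ∑[ j < s ] a j * b j l

  coordinate : ∀ {k} (σ : Fin k → Fin n) → Injective _≡_ _≡_ σ → Basis k
  coordinate σ σ-inj =
    (δ ∘ σ) , independent⇒linIndep (λ e e·δ≈0 s → trans (sym (∑-δ-hit e σ σ-inj s)) (e·δ≈0 (σ s)))

  unit∉coordinate : ∀ {k} (σ : Fin k → Fin n) (σ-inj : Injective _≡_ _≡_ σ) x →
                    (∀ i → σ i ≢ x) → ¬ (δ x ∈⟨ coordinate σ σ-inj ⟩)
  unit∉coordinate {k} σ σ-inj x x∉σ (coef , δx≈) = 1≉0 (begin
    1#                               ≈⟨ δ-diagonal x ⟨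
    δ x x                            ≈⟨ δx≈ x ⟩
    lincomb k coef (δ ∘ σ) x         ≡⟨ lincomb-∑ k coef (δ ∘ σ) x ⟩
    ∑[ i < k ] coef i * δ (σ i) x    ≈⟨ ∑-δ-miss coef σ x x∉σ ⟩
    0#                               ∎)

  ↑-cases : ∀ a b {p} (P : Fin (a ℕ.+ b) → Set p) →
            (∀ i → P (i ↑ˡ b)) → (∀ j → P (a ↑ʳ j)) → ∀ i → P i
  ↑-cases a b P left right i with Fin.splitAt a i in eq
  ... | inj₁ i' = ≡.subst P (Finₚ.splitAt⁻¹-↑ˡ eq) (left i')
  ... | inj₂ j  = ≡.subst P (Finₚ.splitAt⁻¹-↑ʳ eq) (right j)

  -- Independent relations c_s between the
  -- two bases give vectors X_s = ∑ c_s,i u_i = − ∑ c_s,a+j w_j in U ∩ W.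
  intersection : ∀ {a b} d → d ℕ.+ n ≤ a ℕ.+ b → (U : Basis a) (W : Basis b) →
                 Σ (Basis d) λ X → X ⊆⟨⟩ U × X ⊆⟨⟩ W
  intersection {a} {b} d d+n≤a+b (us , us-indep) (ws , ws-indep) =
    (X , independent⇒linIndep X-indep) , (λ s → cU s , λ x → refl) , X⊆W
    where
      R = kernel n d d+n≤a+b (us ++ ws)
      cU : Fin d → Vector Carrier a
      cU s i = coeff R s (i ↑ˡ b)
      cW : Fin d → Vector Carrier b
      cW s j = coeff R s (a ↑ʳ j)
      X : Fin d → Vec
      X s = lincomb a (cU s) us

      split : ∀ (g : Vector Carrier (a ℕ.+ b)) x →
              ∑[ i < a ℕ.+ b ] g i * (us ++ ws) i x ≈
              ∑[ i < a ] g (i ↑ˡ b) * us i x + ∑[ j < b ] g (a ↑ʳ j) * ws j x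
      split g x = trans (∑-split a (λ i → g i * (us ++ ws) i x)) (reflexive (≡.cong₂ _+_
        (sum-cong-≗ {a} (λ i → ≡.cong (λ v → g (i ↑ˡ b) * v x) (Vecₚ.lookup-++ˡ us ws i)))
        (sum-cong-≗ {b} (λ j → ≡.cong (λ v → g (a ↑ʳ j) * v x) (Vecₚ.lookup-++ʳ us ws j)))))

      X⊆W : ∀ s → X s ∈⟨ ws , ws-indep ⟩
      X⊆W s = (λ j → - cW s j) , λ x → begin
        X s x                           ≡⟨ lincomb-∑ a (cU s) us x ⟩
        ∑[ i < a ] cU s i * us i x      ≈⟨ inverseˡ-unique _ _ (trans (sym (split (coeff R s) x))
                                                                   (annihilates R s x)) ⟩
        - (∑[ j < b ] cW s j * ws j x)  ≈⟨ ∑-negate (λ j → cW s j * ws j x) ⟩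
        ∑[ j < b ] - (cW s j * ws j x)  ≈⟨ sum-cong-≋ {b} (λ j → -‿distribˡ-* (cW s j) (ws j x)) ⟩
        ∑[ j < b ] - cW s j * ws j x    ≡⟨ lincomb-∑ b (λ j → - cW s j) ws x ⟨
        lincomb b (λ j → - cW s j) ws x ∎

      -- e·X = 0 forces g = e·c to vanish on the U-part (U independent),
      -- then on the W-part (W independent); so e = 0 as the c_s are independent
      X-indep : Independent X
      X-indep e e·X≈0 = independent R e (↑-cases a b (λ i → g i ≈ 0#) gU≈0 gW≈0)
        where
          g : Vector Carrier (a ℕ.+ b)
          g i = ∑[ s < d ] e s * coeff R s i

          g·rows≈0 : ∀ x → ∑[ i < a ℕ.+ b ] g i * (us ++ ws) i x ≈ 0#
          g·rows≈0 x = trans (sym (∑-mul-assoc e (coeff R) (λ i → (us ++ ws) i x)))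
                             (∑-zero (λ s → e s * (∑[ i < a ℕ.+ b ] coeff R s i * (us ++ ws) i x))
                                     (λ s → trans (*-congˡ (annihilates R s x)) (zeroʳ (e s))))

          gU≈0 : ∀ i → g (i ↑ˡ b) ≈ 0#
          gU≈0 = linIndep⇒independent us-indep (g ∘ (_↑ˡ b)) λ x →
            trans (sym (∑-mul-assoc e cU (λ i → us i x)))
                  (trans (sum-cong-≋ {d} (λ s → *-congˡ (reflexive (≡.sym (lincomb-∑ a (cU s) us x)))))
                         (e·X≈0 x))

          gW≈0 : ∀ j → g (a ↑ʳ j) ≈ 0#
          gW≈0 = linIndep⇒independent ws-indep (g ∘ (a ↑ʳ_)) λ x → begin
            ∑[ j < b ] g (a ↑ʳ j) * ws j x
              ≈⟨ +-identityˡ _ ⟨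
            0# + ∑[ j < b ] g (a ↑ʳ j) * ws j x
              ≈⟨ +-congʳ (∑-zero (λ i → g (i ↑ˡ b) * us i x)
                                 (λ i → trans (*-congʳ (gU≈0 i)) (zeroˡ (us i x)))) ⟨
            ∑[ i < a ] g (i ↑ˡ b) * us i x + ∑[ j < b ] g (a ↑ʳ j) * ws j x
              ≈⟨ split g x ⟨
            ∑[ i < a ℕ.+ b ] g i * (us ++ ws) i x
              ≈⟨ g·rows≈0 x ⟩
            0# ∎

  commonSubspace : ∀ {k} → k ≤ n → ∀ L (V : Fin L → Basis k) d → d ℕ.+ L ℕ.* n ≤ n ℕ.+ L ℕ.* k →
                   Σ (Basis d) λ X → ∀ a → X ⊆⟨⟩ V a
  commonSubspace k≤n zero V d d+0≤n+0 =
    coordinate (λ i → inject≤ i d≤n) (Finₚ.inject≤-injective d≤n d≤n _ _) , λ ()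
    where
      d≤n : d ≤ n
      d≤n = ≡.subst₂ _≤_ (ℕₚ.+-identityʳ d) (ℕₚ.+-identityʳ n) d+0≤n+0
  commonSubspace {k} k≤n (suc L) V d hyp = X , X⊆V
    where
      d' = d ℕ.+ n ∸ k
      rest = commonSubspace k≤n L (V ∘ suc) d' (commonDimension-step {n} {k} {d} {L} k≤n hyp)
      meet = intersection d (ℕₚ.≤-reflexive (≡.sym (ℕₚ.m∸n+n≡m (ℕₚ.≤-trans k≤n (ℕₚ.m≤n+m n d)))))
                          (proj₁ rest) (V zero)
      X = proj₁ meet
      X⊆V : ∀ a → X ⊆⟨⟩ V a
      X⊆V zero    = proj₂ (proj₂ meet)
      X⊆V (suc a) = ⊆-trans X (proj₁ rest) (V (suc a)) (proj₁ (proj₂ meet)) (proj₂ rest a)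

module Packings {c ℓ q} (F : FiniteField c ℓ q) (n : ℕ) where
  open Linear F n
  open FiniteSums (FiniteField.commRing F) using (δ)
  open Subspaces F n

  -- Upper bound: λ+1 blocks would share a t-subspace.
  packingBound : ∀ {k t λ' M} → k ≤ n → λ' ℕ.* n ℕ.+ t ≤ suc λ' ℕ.* k → Packing k t λ' M → M ≤ λ'
  packingBound {k} {t} {λ'} {M} k≤n hyp P with M ℕₚ.≤? λ'
  ... | yes M≤λ = M≤λ
  ... | no  M≰λ = contradiction (proj₂ common) (Packing.atMost P (proj₁ common) pick pick-inj)
    where
      λ<M = ℕₚ.≰⇒> M≰λ
      pick : Fin (suc λ') → Fin M
      pick a = inject≤ a λ<M
      pick-inj : Injective _≡_ _≡_ pick
      pick-inj = Finₚ.inject≤-injective λ<M λ<M _ _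
      common = commonSubspace k≤n (suc λ') (Packing.block P ∘ pick) t
                              (commonDimension-packing {n} {k} {t} {λ'} hyp)

  DistinctBlocks : ℕ → ℕ → Set (c ⊔ ℓ)
  DistinctBlocks k λ' = Σ (Fin λ' → Basis k) λ B → ∀ i j → B i ≡⟨⟩ B j → i ≡ j

  -- Any λ' distinct blocks form a packing: λ'+1 distinct blocks do not exist.
  fewBlocksPacking : ∀ {k t λ'} → DistinctBlocks k λ' → Packing k t λ' λ'
  fewBlocksPacking (B , B-distinct) = record
    { block    = B
    ; distinct = B-distinct
    ; atMost   = λ T f f-inj _ → ℕₚ.1+n≰n (Finₚ.injective⇒≤ f-inj)
    }

  -- For λ' ≤ k < n: inside the coordinate subspace on the first k+1
  -- coordinates, the hyperplanes omitting coordinate j (j < λ') are distinct.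
  hyperplaneBlocks : ∀ {k λ'} → λ' ≤ k → suc k ≤ n → DistinctBlocks k λ'
  hyperplaneBlocks {k} {λ'} λ≤k k<n = B , B-distinct
    where
      ι : Fin (suc k) → Fin n
      ι y = inject≤ y k<n
      ι-inj : Injective _≡_ _≡_ ι
      ι-inj = Finₚ.inject≤-injective k<n k<n _ _
      omit : Fin λ' → Fin (suc k)
      omit j = inject≤ j (ℕₚ.m≤n⇒m≤1+n λ≤k)
      σ : Fin λ' → Fin k → Fin n
      σ j = ι ∘ punchIn (omit j)
      σ-inj : ∀ j → Injective _≡_ _≡_ (σ j)
      σ-inj j = Finₚ.punchIn-injective (omit j) _ _ ∘ ι-inj
      B : Fin λ' → Basis k
      B j = coordinate (σ j) (σ-inj j)
      -- e_{ι(omit j)} lies in B i for i ≠ j but not in B j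
      B-distinct : ∀ i j → B i ≡⟨⟩ B j → i ≡ j
      B-distinct i j (Bi⊆Bj , _) with i Fin.≟ j
      ... | yes i≡j = i≡j
      ... | no  i≢j = contradiction (≡.subst (λ y → δ y ∈⟨ B j ⟩) unit-in-Bi (Bi⊆Bj y))
                        (unit∉coordinate (σ j) (σ-inj j) (ι (omit j))
                           (λ y' eq → Finₚ.punchInᵢ≢i (omit j) y' (ι-inj eq)))
        where
          omit-distinct : omit i ≢ omit j
          omit-distinct = i≢j ∘ Finₚ.inject≤-injective _ _ i j
          y = Fin.punchOut omit-distinct
          unit-in-Bi : σ i y ≡ ι (omit j)
          unit-in-Bi = ≡.cong ι (Finₚ.punchIn-punchOut omit-distinct)

  singleBlock : ∀ {k λ'} → λ' ≤ 1 → k ≤ n → DistinctBlocks k λ'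
  singleBlock {k} (s≤s z≤n) k≤n =
    (λ _ → coordinate (λ i → inject≤ i k≤n) (Finₚ.inject≤-injective k≤n k≤n _ _)) ,
    λ { zero zero _ → ≡.refl }
  singleBlock z≤n k≤n = (λ ()) , λ ()

open import Data.Nat using (_+_; _*_)

proposition33 : {c ℓ : Level} (q : ℕ) (F : FiniteField c ℓ q) (λ' n k t : ℕ) →
                1 ≤ t → t ≤ k → k ≤ n → 1 ≤ λ' → λ' ≤ gauss q (n Data.Nat.∸ t) (k Data.Nat.∸ t) →
                λ' * n + t ≤ suc λ' * k →
                Linear.MaxPacking F n k t λ' λ'
proposition33 q F λ' n k t _ _ k≤n _ λ≤gauss hyp =
  fewBlocksPacking blocks , λ M P → packingBound k≤n hyp P
  where
    open Packings F n
    blocks : DistinctBlocks k λ'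
    blocks with ℕₚ.m≤n⇒m<n∨m≡n k≤n
    ... | inj₁ k<n    = hyperplaneBlocks (condition⇒λ≤k {n} {k} {t} {λ'} hyp k<n) k<n
    ... | inj₂ ≡.refl = singleBlock (≡.subst (λ' ≤_) (gauss-diagonal q (n ∸ t)) λ≤gauss) k≤n
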